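{- Let $n\ge1$ and let $M_n$ be the graph with vertex set $\{0\}\cup\{a_1,\dots,a_n\}\cup\{b_1,\dots,b_n\}$ whose edges are: $0$ adjacent to each $a_i$ (and to nothing else); $b_ib_j$ for all $i\ne j$; and $a_ib_j$ for all $i\ne j$ (no edges among the $a_i$, and no edge $a_ib_i$). For $0\le j\le n$ let $M_j$ be defined likewise ($M_0$ is a single vertex). Then $$\mathcal{H}(M_n)=\{K_k\times M_{n-k}: 0\le k\le n,\ k\ne n-1\}$$ (up to isomorphism); moreover $\chi(M_n)=n+1$ and $|\mathcal{H}(M_n)|=n$.
   Context: All graphs are simple (loopless). For graphs $X_1,X_2$, $X_1\times X_2$ denotes the graph on the disjoint union $V(X_1)\cup V(X_2)$ whose edges are those of $X_1$, those of $X_2$, and all pairs $\{u,v\}$ with $u\in V(X_1)$, $v\in V(X_2)$; $K_0$ is the empty graph, so $K_0\times X=X$. A homomorphism is a map on vertices sending edges to edges. $\mathcal{H}_0(X)$ is the set of homomorphic images of $X$ (graphs with vertex set $h(V(X))$ and edge set $h(E(X))$), up to isomorphism, and $\mathcal{H}(X)$ is the set of minimal elements of $\mathcal{H}_0(X)$ under embeddability as a (not necessarily induced) subgraph. $\chi$ denotes chromatic number. -}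

module Defs where

open import Data.Nat using (ℕ; zero; suc; _+_; _∸_; _≤_)
open import Data.Bool using (Bool; true; false; not; T)
open import Data.Fin using (Fin; splitAt)
open import Data.Fin.Properties using (_≟_)
open import Data.Sum using (_⊎_; inj₁; inj₂)
open import Data.Product using (Σ; ∃; _×_; _,_)
open import Relation.Nullary using (¬_; yes; no; does)
open import Relation.Binary.PropositionalEquality using (_≡_; _≢_; refl; sym)

record Graph : Set where
  field
    V     : ℕ
    adj   : Fin V → Fin V → Bool
    adj-sym   : ∀ x y → adj x y ≡ adj y x
    adj-irr   : ∀ x → adj x x ≡ false
open Graph public

Adj : (G : Graph) → Fin (V G) → Fin (V G) → Set
Adj G x y = T (adj G x y)

neq : ∀ {n} → Fin n → Fin n → Bool
neq i j = not (does (i ≟ j))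

neq-sym : ∀ {n} (i j : Fin n) → neq i j ≡ neq j i
neq-sym i j with i ≟ j | j ≟ i
... | yes _ | yes _ = refl
... | no _  | no _  = refl
... | yes p | no q  with q (sym p)
... | ()
neq-sym i j | no p | yes q with p (sym q)
... | ()

neq-irr : ∀ {n} (i : Fin n) → neq i i ≡ false
neq-irr i with i ≟ i
... | yes _ = refl
... | no p with p refl
... | ()

K : ℕ → Graph
K k = record { V = k ; adj = neq ; adj-sym = neq-sym ; adj-irr = neq-irr }

-- Join X₁ × X₂ (written X₁ ⊗ X₂): disjoint union plus all edges
-- between V(X₁) and V(X₂).  Vertices of X₁ come first.

joinAdj : (X₁ X₂ : Graph) → Fin (V X₁) ⊎ Fin (V X₂) → Fin (V X₁) ⊎ Fin (V X₂) → Bool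
joinAdj X₁ X₂ (inj₁ x) (inj₁ y) = adj X₁ x y
joinAdj X₁ X₂ (inj₁ x) (inj₂ y) = true
joinAdj X₁ X₂ (inj₂ x) (inj₁ y) = true
joinAdj X₁ X₂ (inj₂ x) (inj₂ y) = adj X₂ x y

joinAdj-sym : ∀ X₁ X₂ u v → joinAdj X₁ X₂ u v ≡ joinAdj X₁ X₂ v u
joinAdj-sym X₁ X₂ (inj₁ x) (inj₁ y) = adj-sym X₁ x y
joinAdj-sym X₁ X₂ (inj₁ x) (inj₂ y) = refl
joinAdj-sym X₁ X₂ (inj₂ x) (inj₁ y) = refl
joinAdj-sym X₁ X₂ (inj₂ x) (inj₂ y) = adj-sym X₂ x y

joinAdj-irr : ∀ X₁ X₂ u → joinAdj X₁ X₂ u u ≡ false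
joinAdj-irr X₁ X₂ (inj₁ x) = adj-irr X₁ x
joinAdj-irr X₁ X₂ (inj₂ x) = adj-irr X₂ x

_⊗_ : Graph → Graph → Graph
X₁ ⊗ X₂ = record
  { V = V X₁ + V X₂
  ; adj = λ x y → joinAdj X₁ X₂ (splitAt (V X₁) x) (splitAt (V X₁) y)
  ; adj-sym = λ x y → joinAdj-sym X₁ X₂ (splitAt (V X₁) x) (splitAt (V X₁) y)
  ; adj-irr = λ x → joinAdj-irr X₁ X₂ (splitAt (V X₁) x)
  }

data MVert (j : ℕ) : Set where
  o : MVert j
  a : Fin j → MVert j
  b : Fin j → MVert j

decodeM : ∀ j → Fin (suc (j + j)) → MVert j
decodeM j Fin.zero = o
decodeM j (Fin.suc i) with splitAt j i
... | inj₁ p = a p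
... | inj₂ p = b p

MAdj : ∀ {j} → MVert j → MVert j → Bool
MAdj o     o     = false
MAdj o     (a _) = true
MAdj o     (b _) = false
MAdj (a _) o     = true
MAdj (a _) (a _) = false
MAdj (a p) (b q) = neq p q
MAdj (b _) o     = false
MAdj (b p) (a q) = neq p q
MAdj (b p) (b q) = neq p q

MAdj-sym : ∀ {j} (u v : MVert j) → MAdj u v ≡ MAdj v u
MAdj-sym o     o     = refl
MAdj-sym o     (a _) = refl
MAdj-sym o     (b _) = refl
MAdj-sym (a _) o     = refl
MAdj-sym (a _) (a _) = refl
MAdj-sym (a p) (b q) = neq-sym p q
MAdj-sym (b _) o     = refl
MAdj-sym (b p) (a q) = neq-sym p q
MAdj-sym (b p) (b q) = neq-sym p q

MAdj-irr : ∀ {j} (u : MVert j) → MAdj u u ≡ false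
MAdj-irr o     = refl
MAdj-irr (a _) = refl
MAdj-irr (b p) = neq-irr p

M : ℕ → Graph
M j = record
  { V = suc (j + j)
  ; adj = λ x y → MAdj (decodeM j x) (decodeM j y)
  ; adj-sym = λ x y → MAdj-sym (decodeM j x) (decodeM j y)
  ; adj-irr = λ x → MAdj-irr (decodeM j x)
  }

_≅_ : Graph → Graph → Set
X ≅ Y = Σ (Fin (V X) → Fin (V Y)) λ f → Σ (Fin (V Y) → Fin (V X)) λ g →
          (∀ x → g (f x) ≡ x) × (∀ y → f (g y) ≡ y) ×
          (∀ x x′ → adj X x x′ ≡ adj Y (f x) (f x′))

-- X embeds into Y as a (not necessarily induced) subgraph.
_↪_ : Graph → Graph → Set
X ↪ Y = Σ (Fin (V X) → Fin (V Y)) λ f →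
          (∀ x x′ → f x ≡ f x′ → x ≡ x′) ×
          (∀ x x′ → Adj X x x′ → Adj Y (f x) (f x′))

HomImage : Graph → Graph → Set
HomImage X Y = Σ (Fin (V X) → Fin (V Y)) λ h →
  (∀ x x′ → Adj X x x′ → Adj Y (h x) (h x′)) ×
  (∀ y → ∃ λ x → h x ≡ y) ×
  (∀ y y′ → Adj Y y y′ → ∃ λ x → ∃ λ x′ → Adj X x x′ × h x ≡ y × h x′ ≡ y′)

InH₀ : Graph → Graph → Set
InH₀ X Y = HomImage X Y

InH : Graph → Graph → Set
InH X Y = InH₀ X Y × (∀ Z → InH₀ X Z → Z ↪ Y → Z ≅ Y)

Colorable : ℕ → Graph → Set
Colorable k G = Σ (Fin (V G) → Fin k) λ c → ∀ x y → Adj G x y → c x ≢ c y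

IsChromaticNumber : Graph → ℕ → Set
IsChromaticNumber G m = Colorable m G × (∀ k → Colorable k G → m ≤ k)

HasHCount : Graph → ℕ → Set
HasHCount X m = Σ (Fin m → Graph) λ G →
  (∀ i → InH X (G i)) ×
  (∀ i j → G i ≅ G j → i ≡ j) ×
  (∀ Y → InH X Y → ∃ λ i → Y ≅ G i)

-- For m ≢ 1 every homomorphism M (k + m) → KM k m is onto
-- vertices and edges. The b i form a clique of size k + m. For m ≥ 3, counting and
-- adjacency show that none of them goes to o or to an a p; for m = 2 a rotation of the
-- 5-cycle M 2 arranges this. So they fill the clique vertices and the b p, and then the
-- a i and o are forced. For m = 0 a missed vertex or edge would colour M k with k colours.
-- Hence KM k m is a homomorphic image of M (k + m), and a minimal one, since every image
-- embedding into it is all of it.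
-- Conversely let h map M n onto Y, and call i identified when h (a i) = h (b i). With s
-- identified and t unidentified indices, h either produces a clique on n + 1 vertices or
-- embeds KM s t with t ≢ 1, and minimality of Y makes Y that graph.

module Submission where

open import Defs
open import Data.Nat using (ℕ; suc; _≤_; _∸_)
open import Data.Product using (∃; _×_)
open import Relation.Binary.PropositionalEquality using (_≢_)
open import Function.Bundles using (_⇔_)

open import Data.Nat as ℕ using (zero; _+_; _<_; z≤n; s≤s)
open import Data.Nat.Properties as ℕ using ()
open import Data.Bool using (Bool; true; false; T)
import Data.Bool.Properties as Bool
open import Data.Fin as Fin using (Fin; #_; splitAt; _↑ˡ_; _↑ʳ_; punchOut; toℕ; fromℕ; fromℕ<; inject₁)
open import Data.Fin.Properties as Fin
  using (_≟_; splitAt-↑ˡ; splitAt-↑ʳ; join-splitAt; ↑ˡ-injective; ↑ʳ-injective; any?; all?)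
open import Data.Sum using (_⊎_; inj₁; inj₂; [_,_]′; map₂)
open import Data.Sum.Properties using (inj₁-injective; inj₂-injective; ≡-dec)
open import Data.Product using (∃₂; _,_; proj₁; proj₂)
open import Data.Empty using (⊥; ⊥-elim)
open import Data.Unit using (tt)
open import Relation.Nullary using (¬_; yes; no; Dec)
open import Relation.Nullary.Decidable using (map′; from-yes; _×-dec_; _→-dec_; T?; ¬?)
open import Relation.Binary.PropositionalEquality
  using (_≡_; refl; sym; trans; cong; cong₂; subst; ≢-sym)
open import Function.Bundles using (mk⇔)
open import Function.Base using (_∘_)

neq⇒≢ : ∀ {n} {i j : Fin n} → T (neq i j) → i ≢ j
neq⇒≢ {i = i} {j} t i≡j with i ≟ j
neq⇒≢ () _ | yes _
... | no i≢j = i≢j i≡j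

≢⇒neq : ∀ {n} {i j : Fin n} → i ≢ j → T (neq i j)
≢⇒neq {i = i} {j} i≢j with i ≟ j
... | yes i≡j = i≢j i≡j
... | no _    = tt

≡false⇒¬T : ∀ {x} → x ≡ false → ¬ T x
≡false⇒¬T refl ()

¬neq-refl : ∀ {n} (i : Fin n) → ¬ T (neq i i)
¬neq-refl i = ≡false⇒¬T (neq-irr i)

≡true⇒T : ∀ {x} → x ≡ true → T x
≡true⇒T refl = tt

Adj-sym : ∀ Y {y y′} → Adj Y y y′ → Adj Y y′ y
Adj-sym Y {y} {y′} = subst T (adj-sym Y y y′)

Adj⇒≢ : ∀ Y {y y′} → Adj Y y y′ → y ≢ y′
Adj⇒≢ Y {y} t refl = ≡false⇒¬T (adj-irr Y y) t

≡-≢-trans : ∀ {A : Set} {x y z : A} → x ≡ y → y ≢ z → x ≢ z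
≡-≢-trans refl y≢z = y≢z

injective⇒surjective : ∀ {n} (f : Fin n → Fin n) → (∀ {x y} → f x ≡ f y → x ≡ y) →
                       ∀ y → ∃ λ x → f x ≡ y
injective⇒surjective {zero}  f f-inj ()
injective⇒surjective {suc n} f f-inj y with any? (λ x → f x ≟ y)
... | yes hit = hit
... | no ¬hit = ⊥-elim (ℕ.<-irrefl refl (Fin.injective⇒≤ {f = f′} f′-inj))
  where
  y≢f : ∀ x → y ≢ f x
  y≢f x y≡fx = ¬hit (x , sym y≡fx)
  f′ : Fin (suc n) → Fin n
  f′ x = punchOut (y≢f x)
  f′-inj : ∀ {x x′} → f′ x ≡ f′ x′ → x ≡ x′
  f′-inj eq = f-inj (Fin.punchOut-injective (y≢f _) (y≢f _) eq)

↑ˡ≢↑ʳ : ∀ k m (j : Fin k) (p : Fin m) → j ↑ˡ m ≢ k ↑ʳ p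
↑ˡ≢↑ʳ k m j p eq
  with trans (sym (splitAt-↑ˡ k j m)) (trans (cong (splitAt k) eq) (splitAt-↑ʳ k m p))
... | ()

splitAt-injective : ∀ k m {i j : Fin (k + m)} → splitAt k i ≡ splitAt k j → i ≡ j
splitAt-injective k m {i} {j} eq =
  trans (sym (join-splitAt k m i)) (trans (cong (Fin.join k m) eq) (join-splitAt k m j))

exists-≢ : ∀ {m} → 2 ≤ m → (p : Fin m) → ∃ λ q → q ≢ p
exists-≢ (s≤s (s≤s _)) Fin.zero    = # 1 , λ ()
exists-≢ (s≤s (s≤s _)) (Fin.suc _) = # 0 , λ ()

two-others : ∀ {m} → 3 ≤ m → (p : Fin m) → ∃₂ λ r₁ r₂ → r₁ ≢ p × r₂ ≢ p × r₁ ≢ r₂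
two-others (s≤s (s≤s (s≤s _))) Fin.zero                = # 1 , # 2 , (λ ()) , (λ ()) , λ ()
two-others (s≤s (s≤s (s≤s _))) (Fin.suc Fin.zero)      = # 0 , # 2 , (λ ()) , (λ ()) , λ ()
two-others (s≤s (s≤s (s≤s _))) (Fin.suc (Fin.suc _))   = # 0 , # 1 , (λ ()) , (λ ()) , λ ()

exists-≢₂ : ∀ {m} → 3 ≤ m → (p q : Fin m) → ∃ λ r → r ≢ p × r ≢ q
exists-≢₂ 3≤m p q with two-others 3≤m p
... | r₁ , r₂ , r₁≢p , r₂≢p , r₁≢r₂ with q ≟ r₁
...   | yes refl = r₂ , r₂≢p , ≢-sym r₁≢r₂
...   | no q≢r₁  = r₁ , r₁≢p , ≢-sym q≢r₁

encodeM : ∀ j → MVert j → Fin (suc (j + j))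
encodeM j o     = Fin.zero
encodeM j (a p) = Fin.suc (p ↑ˡ j)
encodeM j (b p) = Fin.suc (j ↑ʳ p)

decodeM-encodeM : ∀ j u → decodeM j (encodeM j u) ≡ u
decodeM-encodeM j o     = refl
decodeM-encodeM j (a p) rewrite splitAt-↑ˡ j p j = refl
decodeM-encodeM j (b p) rewrite splitAt-↑ʳ j j p = refl

encodeM-decodeM : ∀ j x → encodeM j (decodeM j x) ≡ x
encodeM-decodeM j Fin.zero    = refl
encodeM-decodeM j (Fin.suc i) with splitAt j i | join-splitAt j j i
... | inj₁ p | i≡ = cong Fin.suc i≡
... | inj₂ p | i≡ = cong Fin.suc i≡

adj-M-encodeM : ∀ j u v → adj (M j) (encodeM j u) (encodeM j v) ≡ MAdj u v
adj-M-encodeM j u v rewrite decodeM-encodeM j u | decodeM-encodeM j v = refl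

_≟M_ : ∀ {m} (u v : MVert m) → Dec (u ≡ v)
o   ≟M o   = yes refl
o   ≟M a _ = no λ ()
o   ≟M b _ = no λ ()
a _ ≟M o   = no λ ()
a p ≟M a q = map′ (cong a) (λ { refl → refl }) (p ≟ q)
a _ ≟M b _ = no λ ()
b _ ≟M o   = no λ ()
b _ ≟M a _ = no λ ()
b p ≟M b q = map′ (cong b) (λ { refl → refl }) (p ≟ q)

all-MVert? : ∀ {m} {P : MVert m → Set} → (∀ u → Dec (P u)) → Dec (∀ u → P u)
all-MVert? {m} {P} P? =
  map′ (λ h u → subst P (decodeM-encodeM m u) (h (encodeM m u))) (λ h x → h _)
       (all? λ x → P? (decodeM m x))

any-MVert? : ∀ {m} {P : MVert m → Set} → (∀ u → Dec (P u)) → Dec (∃ P)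
any-MVert? {m} {P} P? =
  map′ (λ (x , Px) → decodeM m x , Px)
       (λ (u , Pu) → encodeM m u , subst P (sym (decodeM-encodeM m u)) Pu)
       (any? λ x → P? (decodeM m x))

KMVert : ℕ → ℕ → Set
KMVert k m = Fin k ⊎ MVert m

KMAdj : ∀ {k m} → KMVert k m → KMVert k m → Bool
KMAdj (inj₁ i) (inj₁ j) = neq i j
KMAdj (inj₁ _) (inj₂ _) = true
KMAdj (inj₂ _) (inj₁ _) = true
KMAdj (inj₂ u) (inj₂ v) = MAdj u v

KMAdj-irr : ∀ {k m} (u : KMVert k m) → ¬ T (KMAdj u u)
KMAdj-irr (inj₁ i) = ≡false⇒¬T (neq-irr i)
KMAdj-irr (inj₂ u) = ≡false⇒¬T (MAdj-irr u)

KMAdj⇒≢ : ∀ {k m} {u v : KMVert k m} → T (KMAdj u v) → u ≢ v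
KMAdj⇒≢ {u = u} t refl = KMAdj-irr u t

_≟KM_ : ∀ {k m} (u v : KMVert k m) → Dec (u ≡ v)
_≟KM_ = ≡-dec _≟_ _≟M_

KM : ℕ → ℕ → Graph
KM k m = K k ⊗ M m

decodeKM : ∀ k m → Fin (V (KM k m)) → KMVert k m
decodeKM k m x with splitAt k x
... | inj₁ i = inj₁ i
... | inj₂ y = inj₂ (decodeM m y)

encodeKM : ∀ k m → KMVert k m → Fin (V (KM k m))
encodeKM k m (inj₁ i) = i ↑ˡ suc (m + m)
encodeKM k m (inj₂ u) = k ↑ʳ encodeM m u

decodeKM-encodeKM : ∀ k m u → decodeKM k m (encodeKM k m u) ≡ u
decodeKM-encodeKM k m (inj₁ i) rewrite splitAt-↑ˡ k i (suc (m + m)) = refl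
decodeKM-encodeKM k m (inj₂ u) rewrite splitAt-↑ʳ k (suc (m + m)) (encodeM m u) =
  cong inj₂ (decodeM-encodeM m u)

encodeKM-decodeKM : ∀ k m x → encodeKM k m (decodeKM k m x) ≡ x
encodeKM-decodeKM k m x with splitAt k x | join-splitAt k (suc (m + m)) x
... | inj₁ i | x≡ = x≡
... | inj₂ y | x≡ = trans (cong (k ↑ʳ_) (encodeM-decodeM m y)) x≡

decodeKM-injective : ∀ k m {x y} → decodeKM k m x ≡ decodeKM k m y → x ≡ y
decodeKM-injective k m {x} {y} eq =
  trans (sym (encodeKM-decodeKM k m x)) (trans (cong (encodeKM k m) eq) (encodeKM-decodeKM k m y))

adj-KM-decodeKM : ∀ k m x y → adj (KM k m) x y ≡ KMAdj (decodeKM k m x) (decodeKM k m y)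
adj-KM-decodeKM k m x y with splitAt k x | splitAt k y
... | inj₁ _ | inj₁ _ = refl
... | inj₁ _ | inj₂ _ = refl
... | inj₂ _ | inj₁ _ = refl
... | inj₂ _ | inj₂ _ = refl

adj-KM-encodeKM : ∀ k m u v → adj (KM k m) (encodeKM k m u) (encodeKM k m v) ≡ KMAdj u v
adj-KM-encodeKM k m u v
  rewrite adj-KM-decodeKM k m (encodeKM k m u) (encodeKM k m v)
        | decodeKM-encodeKM k m u | decodeKM-encodeKM k m v = refl

IsHom : (X Y : Graph) → (Fin (V X) → Fin (V Y)) → Set
IsHom X Y h = ∀ x x′ → Adj X x x′ → Adj Y (h x) (h x′)

IsOnto : (X Y : Graph) → (Fin (V X) → Fin (V Y)) → Set
IsOnto X Y h = (∀ y → ∃ λ x → h x ≡ y) ×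
  (∀ y y′ → Adj Y y y′ → ∃ λ x → ∃ λ x′ → Adj X x x′ × h x ≡ y × h x′ ≡ y′)

≅-refl : ∀ X → X ≅ X
≅-refl X = (λ x → x) , (λ x → x) , (λ _ → refl) , (λ _ → refl) , λ _ _ → refl

≅-sym : ∀ {X Y} → X ≅ Y → Y ≅ X
≅-sym {X} {Y} (f , g , g∘f , f∘g , f-adj) = g , f , f∘g , g∘f , λ y y′ →
  trans (cong₂ (adj Y) (sym (f∘g y)) (sym (f∘g y′))) (sym (f-adj (g y) (g y′)))

≅-trans : ∀ {X Y Z} → X ≅ Y → Y ≅ Z → X ≅ Z
≅-trans (f , g , g∘f , f∘g , f-adj) (f′ , g′ , g′∘f′ , f′∘g′ , f′-adj) =
  (λ x → f′ (f x)) , (λ z → g (g′ z)) ,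
  (λ x → trans (cong g (g′∘f′ (f x))) (g∘f x)) ,
  (λ z → trans (cong f′ (f∘g (g′ z))) (f′∘g′ z)) ,
  λ x x′ → trans (f-adj x x′) (f′-adj (f x) (f x′))

≅⇒≡V : ∀ {X Y} → X ≅ Y → V X ≡ V Y
≅⇒≡V (f , g , g∘f , f∘g , _) = Fin.cantor-schröder-bernstein {f = f} {g = g}
  (λ {x} {y} eq → trans (sym (g∘f x)) (trans (cong g eq) (g∘f y)))
  (λ {x} {y} eq → trans (sym (f∘g x)) (trans (cong f eq) (f∘g y)))

↪-respʳ-≅ : ∀ {Z Y Y′} → Z ↪ Y → Y ≅ Y′ → Z ↪ Y′
↪-respʳ-≅ (e , e-inj , e-adj) (f , g , g∘f , _ , f-adj) =
  (λ z → f (e z)) ,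
  (λ z z′ eq → e-inj z z′ (trans (sym (g∘f (e z))) (trans (cong g eq) (g∘f (e z′))))) ,
  λ z z′ t → subst T (f-adj (e z) (e z′)) (e-adj z z′ t)

HomImage-respʳ-≅ : ∀ {X Y Y′} → HomImage X Y → Y ≅ Y′ → HomImage X Y′
HomImage-respʳ-≅ {X} {Y} {Y′} (h , h-hom , h-onV , h-onE) (f , g , g∘f , f∘g , f-adj) =
  (λ x → f (h x)) ,
  (λ x x′ t → subst T (f-adj (h x) (h x′)) (h-hom x x′ t)) ,
  (λ y → let (x , hx≡) = h-onV (g y) in x , trans (cong f hx≡) (f∘g y)) ,
  λ y y′ t →
    let adj-g = trans (f-adj (g y) (g y′)) (cong₂ (adj Y′) (f∘g y) (f∘g y′))
        (x , x′ , t′ , hx≡ , hx′≡) = h-onE (g y) (g y′) (subst T (sym adj-g) t)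
    in x , x′ , t′ , trans (cong f hx≡) (f∘g y) , trans (cong f hx′≡) (f∘g y′)

InH-respʳ-≅ : ∀ {X Y Y′} → InH X Y → Y ≅ Y′ → InH X Y′
InH-respʳ-≅ {X} {Y} {Y′} (Y-image , Y-minimal) Y≅Y′ =
  HomImage-respʳ-≅ {X} {Y} {Y′} Y-image Y≅Y′ ,
  λ Z Z-image Z↪Y′ → ≅-trans {Z} {Y} {Y′}
    (Y-minimal Z Z-image (↪-respʳ-≅ {Z} {Y′} {Y} Z↪Y′ (≅-sym {Y} {Y′} Y≅Y′))) Y≅Y′

homs-onto⇒minimal : ∀ X Y → (∀ h → IsHom X Y h → IsOnto X Y h) →
                    ∀ Z → InH₀ X Z → Z ↪ Y → Z ≅ Y
homs-onto⇒minimal X Y homs-onto Z (h , h-hom , _) (f , f-inj , f-hom) =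
  f , f⁻¹ , f⁻¹∘f , f∘f⁻¹ , adj≡
  where
  fh-onto : IsOnto X Y (λ x → f (h x))
  fh-onto = homs-onto (λ x → f (h x)) (λ x x′ t → f-hom (h x) (h x′) (h-hom x x′ t))
  f⁻¹ : Fin (V Y) → Fin (V Z)
  f⁻¹ y = h (proj₁ (proj₁ fh-onto y))
  f∘f⁻¹ : ∀ y → f (f⁻¹ y) ≡ y
  f∘f⁻¹ y = proj₂ (proj₁ fh-onto y)
  f⁻¹∘f : ∀ z → f⁻¹ (f z) ≡ z
  f⁻¹∘f z = f-inj _ _ (f∘f⁻¹ (f z))
  adj≡ : ∀ z z′ → adj Z z z′ ≡ adj Y (f z) (f z′)
  adj≡ z z′ with adj Z z z′ in zz′ | adj Y (f z) (f z′) in fzz′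
  ... | false | false = refl
  ... | true  | true  = refl
  ... | true  | false = ⊥-elim (≡false⇒¬T fzz′ (f-hom z z′ (≡true⇒T zz′)))
  ... | false | true with proj₂ fh-onto (f z) (f z′) (≡true⇒T fzz′)
  ...   | x , x′ , xx′ , fhx≡ , fhx′≡ with f-inj _ _ fhx≡ | f-inj _ _ fhx′≡
  ...     | refl | refl = ⊥-elim (≡false⇒¬T zz′ (h-hom x x′ xx′))

ProperColouring : ∀ {n c} → (MVert n → Fin c) → Set
ProperColouring col = ∀ u v → T (MAdj u v) → col u ≢ col v

module _ {n c : ℕ} (col : MVert n → Fin c) (proper : ProperColouring col) where

  private
    rainbow : (x : MVert n) → (∀ j → col x ≢ col (b j)) → n < c
    rainbow x x≢b = Fin.injective⇒≤ {f = f} f-injective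
      where
      f : Fin (suc n) → Fin c
      f Fin.zero    = col x
      f (Fin.suc i) = col (b i)
      f-injective : ∀ {i j} → f i ≡ f j → i ≡ j
      f-injective {Fin.zero}  {Fin.zero}  _  = refl
      f-injective {Fin.zero}  {Fin.suc j} eq = ⊥-elim (x≢b j eq)
      f-injective {Fin.suc i} {Fin.zero}  eq = ⊥-elim (x≢b i (sym eq))
      f-injective {Fin.suc i} {Fin.suc j} eq with i ≟ j
      ... | yes i≡j = cong Fin.suc i≡j
      ... | no i≢j  = ⊥-elim (proper (b i) (b j) (≢⇒neq i≢j) eq)

  -- Either every a i has the colour of b i, and then o and the b i get distinct colours,
  -- or some a i₀ does not, and then a i₀ and the b i do.
  ProperColouring⇒n<c : n < c
  ProperColouring⇒n<c with all? (λ i → col (a i) ≟ col (b i))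
  ... | yes same = rainbow o λ j eq → proper o (a j) tt (trans eq (sym (same j)))
  ... | no ¬same with Fin.¬∀⟶∃¬ n _ (λ i → col (a i) ≟ col (b i)) ¬same
  ...   | i₀ , differ = rainbow (a i₀) a≢b
    where
    a≢b : ∀ j → col (a i₀) ≢ col (b j)
    a≢b j with i₀ ≟ j
    ... | yes refl = differ
    ... | no i₀≢j  = proper (a i₀) (b j) (≢⇒neq i₀≢j)

colourM : ∀ n → MVert n → Fin (suc n)
colourM n o     = fromℕ n
colourM n (a i) = inject₁ i
colourM n (b i) = inject₁ i

colourM-proper : ∀ n → ProperColouring (colourM n)
colourM-proper n o     (a i) _  = Fin.fromℕ≢inject₁
colourM-proper n (a i) o     _  = Fin.fromℕ≢inject₁ ∘ sym
colourM-proper n (a i) (b j) ij = neq⇒≢ ij ∘ Fin.inject₁-injective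
colourM-proper n (b i) (a j) ij = neq⇒≢ ij ∘ Fin.inject₁-injective
colourM-proper n (b i) (b j) ij = neq⇒≢ ij ∘ Fin.inject₁-injective

χ-M : ∀ n → IsChromaticNumber (M n) (suc n)
χ-M n = ((λ x → colourM n (decodeM n x)) , λ x y → colourM-proper n (decodeM n x) (decodeM n y)) ,
        λ c (col , proper) → ProperColouring⇒n<c (λ u → col (encodeM n u))
          λ u v uv → proper (encodeM n u) (encodeM n v) (subst T (sym (adj-M-encodeM n u v)) uv)

module _ {n k m : ℕ} where

  PreservesAdj : (MVert n → KMVert k m) → Set
  PreservesAdj g = ∀ u v → T (MAdj u v) → T (KMAdj (g u) (g v))

  OntoVertices : (MVert n → KMVert k m) → Set
  OntoVertices g = ∀ w → ∃ λ u → g u ≡ w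

  EdgeHit : (MVert n → KMVert k m) → KMVert k m → KMVert k m → Set
  EdgeHit g w w′ = ∃₂ λ u u′ → T (MAdj u u′) × g u ≡ w × g u′ ≡ w′

  EdgeHit-swap : ∀ g {w w′} → EdgeHit g w w′ → EdgeHit g w′ w
  EdgeHit-swap g (u , u′ , uu′ , gu , gu′) = u′ , u , subst T (MAdj-sym u u′) uu′ , gu′ , gu

  OntoEdges : (MVert n → KMVert k m) → Set
  OntoEdges g = ∀ w w′ → T (KMAdj w w′) → EdgeHit g w w′

module HomToKM {k m : ℕ} (g : MVert (k + m) → KMVert k m) (g-hom : PreservesAdj g) where

  β α : Fin (k + m) → KMVert k m
  β i = g (b i)
  α i = g (a i)

  ω : KMVert k m
  ω = g o

  b-≢ : ∀ {p q : Fin m} → p ≢ q → inj₂ {A = Fin k} (b p) ≢ inj₂ (b q)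
  b-≢ p≢q refl = p≢q refl

  a-≢ : ∀ {p q : Fin m} → p ≢ q → inj₂ {A = Fin k} (a p) ≢ inj₂ (a q)
  a-≢ p≢q refl = p≢q refl

  β-adj : ∀ {i j x y} → i ≢ j → β i ≡ x → β j ≡ y → T (KMAdj x y)
  β-adj i≢j refl refl = g-hom (b _) (b _) (≢⇒neq i≢j)

  index-≢ : ∀ {i j x y} → β i ≡ x → β j ≡ y → x ≢ y → i ≢ j
  index-≢ βi βj x≢y refl = x≢y (trans (sym βi) βj)

  α-adj : ∀ {i l x y} → α i ≡ x → β l ≡ y → β i ≢ y → T (KMAdj x y)
  α-adj {i} {l} refl refl βi≢βl = g-hom (a i) (b l) (≢⇒neq {i = i} {l} λ { refl → βi≢βl refl })

  ω-adj : ∀ {i x y} → ω ≡ x → α i ≡ y → T (KMAdj x y)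
  ω-adj refl refl = g-hom o (a _) tt

  -- The b i form a clique.
  merges-nonadjacent⇒injective : ∀ {N} (c : KMVert k m → Fin N) →
    (∀ {i j} → c (β i) ≡ c (β j) → ¬ T (KMAdj (β i) (β j))) →
    ∀ {i j} → c (β i) ≡ c (β j) → i ≡ j
  merges-nonadjacent⇒injective c merge {i} {j} eq with i ≟ j
  ... | yes i≡j = i≡j
  ... | no i≢j  = ⊥-elim (merge eq (β-adj i≢j refl refl))

  -- Slots: the k clique vertices and one for each pair {a p, b p}; the k + m images of
  -- the b i fill all of them.
  module Slots (p₀ : Fin m) (β≢o : ∀ i → β i ≢ inj₂ o) where

    slot : KMVert k m → Fin (k + m)
    slot (inj₁ j)     = j ↑ˡ m
    slot (inj₂ o)     = k ↑ʳ p₀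
    slot (inj₂ (a p)) = k ↑ʳ p
    slot (inj₂ (b p)) = k ↑ʳ p

    slot-merges-nonadjacent : ∀ {i j} → slot (β i) ≡ slot (β j) → ¬ T (KMAdj (β i) (β j))
    slot-merges-nonadjacent {i} {j} eq with β i in βi | β j in βj
    ... | inj₂ o | _ = ⊥-elim (β≢o i βi)
    ... | _ | inj₂ o = ⊥-elim (β≢o j βj)
    ... | inj₁ x     | inj₂ (a q) = ⊥-elim (↑ˡ≢↑ʳ k m x q eq)
    ... | inj₁ x     | inj₂ (b q) = ⊥-elim (↑ˡ≢↑ʳ k m x q eq)
    ... | inj₂ (a p) | inj₁ y     = ⊥-elim (↑ˡ≢↑ʳ k m y p (sym eq))
    ... | inj₂ (b p) | inj₁ y     = ⊥-elim (↑ˡ≢↑ʳ k m y p (sym eq))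
    ... | inj₁ x     | inj₁ y     rewrite ↑ˡ-injective m x y eq = ¬neq-refl y
    ... | inj₂ (a p) | inj₂ (a q) = λ ()
    ... | inj₂ (a p) | inj₂ (b q) rewrite ↑ʳ-injective k p q eq = ¬neq-refl q
    ... | inj₂ (b p) | inj₂ (a q) rewrite ↑ʳ-injective k p q eq = ¬neq-refl q
    ... | inj₂ (b p) | inj₂ (b q) rewrite ↑ʳ-injective k p q eq = ¬neq-refl q

    slot-hit : ∀ s → ∃ λ i → slot (β i) ≡ s
    slot-hit = injective⇒surjective (λ i → slot (β i))
                 (merges-nonadjacent⇒injective slot slot-merges-nonadjacent)

    clique-hit : ∀ j → ∃ λ i → β i ≡ inj₁ j
    clique-hit j with slot-hit (j ↑ˡ m)
    ... | i , eq with β i in βi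
    ...   | inj₁ x     rewrite ↑ˡ-injective m x j eq = i , βi
    ...   | inj₂ o     = ⊥-elim (β≢o i βi)
    ...   | inj₂ (a p) = ⊥-elim (↑ˡ≢↑ʳ k m j p (sym eq))
    ...   | inj₂ (b p) = ⊥-elim (↑ˡ≢↑ʳ k m j p (sym eq))

    ab-hit : ∀ p → ∃ λ i → β i ≡ inj₂ (a p) ⊎ β i ≡ inj₂ (b p)
    ab-hit p with slot-hit (k ↑ʳ p)
    ... | i , eq with β i in βi
    ...   | inj₁ x     = ⊥-elim (↑ˡ≢↑ʳ k m x p eq)
    ...   | inj₂ o     = ⊥-elim (β≢o i βi)
    ...   | inj₂ (a q) rewrite ↑ʳ-injective k q p eq = i , inj₁ βi
    ...   | inj₂ (b q) rewrite ↑ʳ-injective k q p eq = i , inj₂ βi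

  module FromBShape (2≤m : 2 ≤ m)
    (shape : ∀ i → (∃ λ j → β i ≡ inj₁ j) ⊎ (∃ λ p → β i ≡ inj₂ (b p))) where

    p₀ : Fin m
    p₀ = fromℕ< (ℕ.≤-trans (s≤s z≤n) 2≤m)

    β≢o : ∀ i → β i ≢ inj₂ o
    β≢o i βi with shape i
    ... | inj₁ (_ , βi′) with trans (sym βi′) βi
    ...   | ()
    β≢o i βi | inj₂ (_ , βi′) with trans (sym βi′) βi
    ...   | ()

    open Slots p₀ β≢o

    b-hit : ∀ p → ∃ λ i → β i ≡ inj₂ (b p)
    b-hit p with ab-hit p
    ... | i , inj₂ βi = i , βi
    ... | i , inj₁ βi with shape i
    ...   | inj₁ (_ , βi′) with trans (sym βi) βi′
    ...     | ()
    b-hit p | i , inj₁ βi | inj₂ (_ , βi′) with trans (sym βi) βi′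
    ...     | ()

    α-clique : ∀ i j → β i ≡ inj₁ j → α i ≡ inj₁ j
    α-clique i j βi with α i in αi
    ... | inj₁ j′ with j′ ≟ j
    ...   | yes refl = refl
    ...   | no j′≢j  = ⊥-elim (¬neq-refl j′
              (α-adj αi (proj₂ (clique-hit j′)) (≡-≢-trans βi λ { refl → j′≢j refl })))
    α-clique i j βi | inj₂ o     = ⊥-elim (α-adj αi (proj₂ (b-hit p₀)) (≡-≢-trans βi λ ()))
    α-clique i j βi | inj₂ (a p) = ⊥-elim (¬neq-refl p (α-adj αi (proj₂ (b-hit p)) (≡-≢-trans βi λ ())))
    α-clique i j βi | inj₂ (b p) = ⊥-elim (¬neq-refl p (α-adj αi (proj₂ (b-hit p)) (≡-≢-trans βi λ ())))

    α-on-b : ∀ i p → β i ≡ inj₂ (b p) → α i ≡ inj₂ (a p) ⊎ α i ≡ inj₂ (b p)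
    α-on-b i p βi with α i in αi
    ... | inj₁ j = ⊥-elim (¬neq-refl j (α-adj αi (proj₂ (clique-hit j)) (≡-≢-trans βi λ ())))
    ... | inj₂ o = let q , q≢p = exists-≢ 2≤m p in
                   ⊥-elim (α-adj αi (proj₂ (b-hit q)) (≡-≢-trans βi (b-≢ (≢-sym q≢p))))
    ... | inj₂ (a q) with q ≟ p
    ...   | yes refl = inj₁ refl
    ...   | no q≢p   = ⊥-elim (¬neq-refl q (α-adj αi (proj₂ (b-hit q)) (≡-≢-trans βi (b-≢ (≢-sym q≢p)))))
    α-on-b i p βi | inj₂ (b q) with q ≟ p
    ...   | yes refl = inj₂ refl
    ...   | no q≢p   = ⊥-elim (¬neq-refl q (α-adj αi (proj₂ (b-hit q)) (≡-≢-trans βi (b-≢ (≢-sym q≢p)))))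

    ω≡o : ω ≡ inj₂ o
    ω≡o with ω in ωeq
    ... | inj₁ j = let i , βi = clique-hit j in ⊥-elim (¬neq-refl j (ω-adj ωeq (α-clique i j βi)))
    ... | inj₂ o = refl
    ... | inj₂ (a r) with α-on-b _ r (proj₂ (b-hit r))
    ...   | inj₁ αi = ⊥-elim (ω-adj ωeq αi)
    ...   | inj₂ αi = ⊥-elim (¬neq-refl r (ω-adj ωeq αi))
    ω≡o | inj₂ (b r) with α-on-b _ r (proj₂ (b-hit r))
    ...   | inj₁ αi = ⊥-elim (¬neq-refl r (ω-adj ωeq αi))
    ...   | inj₂ αi = ⊥-elim (¬neq-refl r (ω-adj ωeq αi))

    α-a : ∀ i p → β i ≡ inj₂ (b p) → α i ≡ inj₂ (a p)
    α-a i p βi with α-on-b i p βi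
    ... | inj₁ αi = αi
    ... | inj₂ αi = ⊥-elim (ω-adj ω≡o αi)

    onto-vertices : OntoVertices g
    onto-vertices (inj₁ j)     = b (proj₁ (clique-hit j)) , proj₂ (clique-hit j)
    onto-vertices (inj₂ o)     = o , ω≡o
    onto-vertices (inj₂ (a p)) = a (proj₁ (b-hit p)) , α-a _ p (proj₂ (b-hit p))
    onto-vertices (inj₂ (b p)) = b (proj₁ (b-hit p)) , proj₂ (b-hit p)

    edge-from-clique : ∀ j w → T (KMAdj (inj₁ j) w) → EdgeHit g (inj₁ j) w
    edge-from-clique j (inj₁ j′) t =
      let i , βi = clique-hit j ; i′ , βi′ = clique-hit j′ in
      b i , b i′ , ≢⇒neq (index-≢ βi βi′ (neq⇒≢ t ∘ inj₁-injective)) , βi , βi′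
    edge-from-clique j (inj₂ o) _ =
      let i , βi = clique-hit j in
      a i , o , tt , α-clique i j βi , ω≡o
    edge-from-clique j (inj₂ (a p)) _ =
      let i , βi = clique-hit j ; i′ , βi′ = b-hit p in
      b i , a i′ , ≢⇒neq (index-≢ βi βi′ λ ()) , βi , α-a i′ p βi′
    edge-from-clique j (inj₂ (b p)) _ =
      let i , βi = clique-hit j ; i′ , βi′ = b-hit p in
      b i , b i′ , ≢⇒neq (index-≢ βi βi′ λ ()) , βi , βi′

    edge-oa : ∀ p → EdgeHit g (inj₂ o) (inj₂ (a p))
    edge-oa p = let i , βi = b-hit p in o , a i , tt , ω≡o , α-a i p βi

    edge-ab : ∀ p q → T (neq p q) → EdgeHit g (inj₂ (a p)) (inj₂ (b q))
    edge-ab p q t =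
      let i , βi = b-hit p ; i′ , βi′ = b-hit q in
      a i , b i′ , ≢⇒neq (index-≢ βi βi′ (b-≢ (neq⇒≢ t))) , α-a i p βi , βi′

    edge-bb : ∀ p q → T (neq p q) → EdgeHit g (inj₂ (b p)) (inj₂ (b q))
    edge-bb p q t =
      let i , βi = b-hit p ; i′ , βi′ = b-hit q in
      b i , b i′ , ≢⇒neq (index-≢ βi βi′ (b-≢ (neq⇒≢ t))) , βi , βi′

    onto-edges : OntoEdges g
    onto-edges (inj₁ j) w t = edge-from-clique j w t
    onto-edges (inj₂ u) (inj₁ j) _ = EdgeHit-swap g (edge-from-clique j (inj₂ u) tt)
    onto-edges (inj₂ o) (inj₂ (a p)) _ = edge-oa p
    onto-edges (inj₂ (a p)) (inj₂ o) _ = EdgeHit-swap g (edge-oa p)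
    onto-edges (inj₂ (a p)) (inj₂ (b q)) t = edge-ab p q t
    onto-edges (inj₂ (b p)) (inj₂ (a q)) t = EdgeHit-swap g (edge-ab q p (subst T (neq-sym p q) t))
    onto-edges (inj₂ (b p)) (inj₂ (b q)) t = edge-bb p q t

  module ThreeOrMore (3≤m : 3 ≤ m) where

    2≤m : 2 ≤ m
    2≤m = ℕ.≤-trans (s≤s (s≤s z≤n)) 3≤m

    -- If b i₀ went to o, no b i could go to a b-vertex, and the k + m images of the b i would
    -- be pairwise adjacent, hence in distinct classes among: clique vertices, {o, b's}, {a's}.
    β≢o : ∀ i → β i ≢ inj₂ o
    β≢o i₀ βi₀ = ℕ.<⇒≱ 3≤m (ℕ.+-cancelˡ-≤ k m 2 (Fin.injective⇒≤ {f = λ i → class (β i)}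
                   (merges-nonadjacent⇒injective class class-merges-nonadjacent)))
      where
      no-b : ∀ j q → β j ≢ inj₂ (b q)
      no-b j q βj with j ≟ i₀
      ... | yes refl with trans (sym βj) βi₀
      ...   | ()
      no-b j q βj | no j≢i₀ = β-adj j≢i₀ βj βi₀

      class : KMVert k m → Fin (k + 2)
      class (inj₁ j)     = j ↑ˡ 2
      class (inj₂ o)     = k ↑ʳ # 0
      class (inj₂ (a _)) = k ↑ʳ # 1
      class (inj₂ (b _)) = k ↑ʳ # 0

      class-merges-nonadjacent : ∀ {i j} → class (β i) ≡ class (β j) → ¬ T (KMAdj (β i) (β j))
      class-merges-nonadjacent {i} {j} eq with β i in βi | β j in βj
      ... | inj₂ (b q) | _ = ⊥-elim (no-b i q βi)
      ... | _ | inj₂ (b q) = ⊥-elim (no-b j q βj)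
      ... | inj₁ x     | inj₁ y     rewrite ↑ˡ-injective 2 x y eq = ¬neq-refl y
      ... | inj₁ x     | inj₂ o     = ⊥-elim (↑ˡ≢↑ʳ k 2 x _ eq)
      ... | inj₁ x     | inj₂ (a _) = ⊥-elim (↑ˡ≢↑ʳ k 2 x _ eq)
      ... | inj₂ o     | inj₁ y     = ⊥-elim (↑ˡ≢↑ʳ k 2 y _ (sym eq))
      ... | inj₂ (a _) | inj₁ y     = ⊥-elim (↑ˡ≢↑ʳ k 2 y _ (sym eq))
      ... | inj₂ o     | inj₂ o     = λ ()
      ... | inj₂ (a _) | inj₂ (a _) = λ ()
      ... | inj₂ o     | inj₂ (a _) with ↑ʳ-injective k (# 0) (# 1) eq
      ...   | ()
      class-merges-nonadjacent eq | inj₂ (a _) | inj₂ o with ↑ʳ-injective k (# 1) (# 0) eq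
      ...   | ()

    open Slots (fromℕ< (ℕ.≤-trans (s≤s z≤n) 3≤m)) β≢o

    β≢a : ∀ i₀ p → β i₀ ≢ inj₂ (a p)
    β≢a i₀ p βi₀ = ω-contradiction
      where
      b-hit : ∀ q → q ≢ p → ∃ λ l → β l ≡ inj₂ (b q)
      b-hit q q≢p with ab-hit q
      ... | l , inj₂ βl = l , βl
      ... | l , inj₁ βl = ⊥-elim (β-adj (index-≢ βl βi₀ (a-≢ q≢p)) βl βi₀)

      α-at-i₀ : α i₀ ≡ inj₂ (a p) ⊎ α i₀ ≡ inj₂ (b p)
      α-at-i₀ with α i₀ in αi
      ... | inj₁ j = ⊥-elim (¬neq-refl j (α-adj αi (proj₂ (clique-hit j)) (≡-≢-trans βi₀ λ ())))
      ... | inj₂ o = let q , q≢p = exists-≢ 2≤m p in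
                     ⊥-elim (α-adj αi (proj₂ (b-hit q q≢p)) (≡-≢-trans βi₀ λ ()))
      ... | inj₂ (a r) with r ≟ p
      ...   | yes refl = inj₁ refl
      ...   | no r≢p   = ⊥-elim (¬neq-refl r (α-adj αi (proj₂ (b-hit r r≢p)) (≡-≢-trans βi₀ λ ())))
      α-at-i₀ | inj₂ (b r) with r ≟ p
      ...   | yes refl = inj₂ refl
      ...   | no r≢p   = ⊥-elim (¬neq-refl r (α-adj αi (proj₂ (b-hit r r≢p)) (≡-≢-trans βi₀ λ ())))

      α-at-b : ∀ q l → q ≢ p → β l ≡ inj₂ (b q) → α l ≡ inj₂ (b q)
      α-at-b q l q≢p βl with α l in αl
      ... | inj₁ j = ⊥-elim (¬neq-refl j (α-adj αl (proj₂ (clique-hit j)) (≡-≢-trans βl λ ())))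
      ... | inj₂ o with exists-≢₂ 3≤m p q
      ...   | r , r≢p , r≢q = ⊥-elim (α-adj αl (proj₂ (b-hit r r≢p)) (≡-≢-trans βl (b-≢ (≢-sym r≢q))))
      α-at-b q l q≢p βl | inj₂ (a r) = ⊥-elim (α-adj αl βi₀ (≡-≢-trans βl λ ()))
      α-at-b q l q≢p βl | inj₂ (b r) with r ≟ q | r ≟ p
      ... | yes refl | _        = refl
      ... | no _     | yes refl = ⊥-elim (¬neq-refl r (α-adj αl βi₀ (≡-≢-trans βl λ ())))
      ... | no r≢q   | no r≢p   =
        ⊥-elim (¬neq-refl r (α-adj αl (proj₂ (b-hit r r≢p)) (≡-≢-trans βl (b-≢ (≢-sym r≢q)))))

      α-at-clique : ∀ j l → β l ≡ inj₁ j → α l ≡ inj₁ j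
      α-at-clique j l βl with α l in αl
      ... | inj₁ j′ with j′ ≟ j
      ...   | yes refl = refl
      ...   | no j′≢j  = ⊥-elim (¬neq-refl j′
                (α-adj αl (proj₂ (clique-hit j′)) (≡-≢-trans βl λ { refl → j′≢j refl })))
      α-at-clique j l βl | inj₂ o = let q , q≢p = exists-≢ 2≤m p in
        ⊥-elim (α-adj αl (proj₂ (b-hit q q≢p)) (≡-≢-trans βl λ ()))
      α-at-clique j l βl | inj₂ (a r) = ⊥-elim (α-adj αl βi₀ (≡-≢-trans βl λ ()))
      α-at-clique j l βl | inj₂ (b r) with r ≟ p
      ... | yes refl = ⊥-elim (¬neq-refl r (α-adj αl βi₀ (≡-≢-trans βl λ ())))
      ... | no r≢p   = ⊥-elim (¬neq-refl r (α-adj αl (proj₂ (b-hit r r≢p)) (≡-≢-trans βl λ ())))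

      ω-contradiction : ⊥
      ω-contradiction with ω in ωeq
      ... | inj₁ j = let l , βl = clique-hit j in ¬neq-refl j (ω-adj ωeq (α-at-clique j l βl))
      ... | inj₂ o = let q , q≢p = exists-≢ 2≤m p ; l , βl = b-hit q q≢p in
                     ω-adj ωeq (α-at-b q l q≢p βl)
      ... | inj₂ (a r) with r ≟ p
      ...   | yes refl = [ ω-adj ωeq , ¬neq-refl r ∘ ω-adj ωeq ]′ α-at-i₀
      ...   | no r≢p   = let l , βl = b-hit r r≢p in ¬neq-refl r (ω-adj ωeq (α-at-b r l r≢p βl))
      ω-contradiction | inj₂ (b r) with r ≟ p
      ...   | yes refl = [ ¬neq-refl r ∘ ω-adj ωeq , ¬neq-refl r ∘ ω-adj ωeq ]′ α-at-i₀
      ...   | no r≢p   = let l , βl = b-hit r r≢p in ¬neq-refl r (ω-adj ωeq (α-at-b r l r≢p βl))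

    shape : ∀ i → (∃ λ j → β i ≡ inj₁ j) ⊎ (∃ λ p → β i ≡ inj₂ (b p))
    shape i with β i in βi
    ... | inj₁ j     = inj₁ (j , refl)
    ... | inj₂ o     = ⊥-elim (β≢o i βi)
    ... | inj₂ (a p) = ⊥-elim (β≢a i p βi)
    ... | inj₂ (b p) = inj₂ (p , refl)

    open FromBShape 2≤m shape public using (onto-vertices; onto-edges)

module _ {m : ℕ} (ψ : MVert m → MVert m)
  (ψ-adj : ∀ u v → MAdj (ψ u) (ψ v) ≡ MAdj u v) (ψ-injective : ∀ {u v} → ψ u ≡ ψ v → u ≡ v) where

  private
    ψ̂ : ∀ {k} → KMVert k m → KMVert k m
    ψ̂ = map₂ ψ

    ψ̂-adj : ∀ {k} (u v : KMVert k m) → KMAdj (ψ̂ u) (ψ̂ v) ≡ KMAdj u v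
    ψ̂-adj (inj₁ _) (inj₁ _) = refl
    ψ̂-adj (inj₁ _) (inj₂ _) = refl
    ψ̂-adj (inj₂ _) (inj₁ _) = refl
    ψ̂-adj (inj₂ u) (inj₂ v) = ψ-adj u v

    ψ̂-injective : ∀ {k} {u v : KMVert k m} → ψ̂ u ≡ ψ̂ v → u ≡ v
    ψ̂-injective {u = inj₁ _} {inj₁ _} refl = refl
    ψ̂-injective {u = inj₂ _} {inj₂ _} eq = cong inj₂ (ψ-injective (inj₂-injective eq))

  PreservesAdj-∘ : ∀ {n k} (g : MVert n → KMVert k m) → PreservesAdj g → PreservesAdj (map₂ ψ ∘ g)
  PreservesAdj-∘ g g-hom u v uv = subst T (sym (ψ̂-adj (g u) (g v))) (g-hom u v uv)

  OntoVertices-∘⁻ : ∀ {n k} (g : MVert n → KMVert k m) → OntoVertices (map₂ ψ ∘ g) → OntoVertices g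
  OntoVertices-∘⁻ g onto w = let u , ψgu≡ = onto (ψ̂ w) in u , ψ̂-injective ψgu≡

  OntoEdges-∘⁻ : ∀ {n k} (g : MVert n → KMVert k m) → OntoEdges (map₂ ψ ∘ g) → OntoEdges g
  OntoEdges-∘⁻ g onto w w′ ww′ =
    let u , u′ , uu′ , ψgu≡ , ψgu′≡ = onto (ψ̂ w) (ψ̂ w′) (subst T (sym (ψ̂-adj w w′)) ww′)
    in u , u′ , uu′ , ψ̂-injective ψgu≡ , ψ̂-injective ψgu′≡

-- M 2 is the 5-cycle o, a 0, b 1, b 0, a 1 and ρ is its rotation.
ρ : MVert 2 → MVert 2
ρ o                  = a (# 0)
ρ (a Fin.zero)       = b (# 1)
ρ (a (Fin.suc _))    = o
ρ (b Fin.zero)       = a (# 1)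
ρ (b (Fin.suc _))    = b (# 0)

ρ-adj : ∀ u v → MAdj (ρ u) (ρ v) ≡ MAdj u v
ρ-adj = from-yes (all-MVert? {2} λ u → all-MVert? {2} λ v → MAdj (ρ u) (ρ v) Bool.≟ MAdj u v)

ρ-injective : ∀ {u v} → ρ u ≡ ρ v → u ≡ v
ρ-injective {u} {v} = from-yes (all-MVert? {2} λ u → all-MVert? {2} λ v → ρ u ≟M ρ v →-dec u ≟M v) u v

rotate : ℕ → MVert 2 → MVert 2
rotate zero    u = u
rotate (suc r) u = ρ (rotate r u)

rotate-adj : ∀ r u v → MAdj (rotate r u) (rotate r v) ≡ MAdj u v
rotate-adj zero    u v = refl
rotate-adj (suc r) u v = trans (ρ-adj (rotate r u) (rotate r v)) (rotate-adj r u v)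

rotate-injective : ∀ r {u v} → rotate r u ≡ rotate r v → u ≡ v
rotate-injective zero    eq = eq
rotate-injective (suc r) eq = rotate-injective r (ρ-injective eq)

IsB : ∀ {m} → MVert m → Set
IsB u = ∃ λ p → u ≡ b p

isB? : ∀ {m} (u : MVert m) → Dec (IsB u)
isB? o     = no λ ()
isB? (a _) = no λ ()
isB? (b p) = yes (p , refl)

rotate-edge-to-bb : ∀ u v → T (MAdj u v) → ∃ λ (r : Fin 5) → IsB (rotate (toℕ r) u) × IsB (rotate (toℕ r) v)
rotate-edge-to-bb = from-yes (all-MVert? {2} λ u → all-MVert? {2} λ v →
  T? (MAdj u v) →-dec any? {5} λ r → isB? (rotate (toℕ r) u) ×-dec isB? (rotate (toℕ r) v))

M₂-triangle-free : ∀ u v w → T (MAdj u v) → T (MAdj v w) → ¬ T (MAdj u w)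
M₂-triangle-free u v w uv vw uw = from-yes
  (all-MVert? {2} λ u → all-MVert? {2} λ v → all-MVert? {2} λ w →
     ¬? (T? (MAdj u v) ×-dec T? (MAdj v w) ×-dec T? (MAdj u w)))
  u v w (uv , vw , uw)

module HomToKM₂ {k : ℕ} (g : MVert (k + 2) → KMVert k 2) (g-hom : PreservesAdj g) where
  open HomToKM g g-hom using (β; β-adj)

  part : KMVert k 2 → Fin (k + 1)
  part (inj₁ j) = j ↑ˡ 1
  part (inj₂ _) = k ↑ʳ Fin.zero

  two-in-M : ∃₂ λ i j → i ≢ j × (∃ λ u → β i ≡ inj₂ u) × (∃ λ v → β j ≡ inj₂ v)
  two-in-M with Fin.pigeonhole (ℕ.+-monoʳ-< k (s≤s (s≤s z≤n))) (λ i → part (β i))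
  ... | i , j , i<j , eq with β i in βi | β j in βj
  ...   | inj₁ x | inj₁ y rewrite ↑ˡ-injective 1 x y eq =
          ⊥-elim (¬neq-refl y (β-adj (Fin.<⇒≢ i<j) βi βj))
  ...   | inj₁ x | inj₂ _ = ⊥-elim (↑ˡ≢↑ʳ k 1 x Fin.zero eq)
  ...   | inj₂ _ | inj₁ y = ⊥-elim (↑ˡ≢↑ʳ k 1 y Fin.zero (sym eq))
  ...   | inj₂ u | inj₂ v = i , j , Fin.<⇒≢ i<j , (u , βi) , (v , βj)

  -- Rotate M 2 until the edge β i β j lies on the b's; the other b l then go to the clique,
  -- since M 2 has no triangles.
  onto : OntoVertices g × OntoEdges g
  onto with two-in-M
  ... | i , j , i≢j , (u , βi) , (v , βj) with rotate-edge-to-bb u v (β-adj i≢j βi βj)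
  ...   | r , (p , ψu≡) , (q , ψv≡) =
          OntoVertices-∘⁻ ψ (rotate-adj (toℕ r)) (rotate-injective (toℕ r)) g Rotated.onto-vertices ,
          OntoEdges-∘⁻ ψ (rotate-adj (toℕ r)) (rotate-injective (toℕ r)) g Rotated.onto-edges
    where
    ψ : MVert 2 → MVert 2
    ψ = rotate (toℕ r)

    ψ̂∘g-hom : PreservesAdj (map₂ ψ ∘ g)
    ψ̂∘g-hom = PreservesAdj-∘ ψ (rotate-adj (toℕ r)) (rotate-injective (toℕ r)) g g-hom

    shape : ∀ l → (∃ λ c → map₂ ψ (β l) ≡ inj₁ c) ⊎ (∃ λ s → map₂ ψ (β l) ≡ inj₂ (b s))
    shape l with l ≟ i | l ≟ j
    ... | yes refl | _ = inj₂ (p , trans (cong (map₂ ψ) βi) (cong inj₂ ψu≡))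
    ... | _ | yes refl = inj₂ (q , trans (cong (map₂ ψ) βj) (cong inj₂ ψv≡))
    ... | no l≢i | no l≢j with β l in βl
    ...   | inj₁ c = inj₁ (c , refl)
    ...   | inj₂ w = ⊥-elim (M₂-triangle-free u v w
                       (β-adj i≢j βi βj) (β-adj (≢-sym l≢j) βj βl) (β-adj (≢-sym l≢i) βi βl))

    module Rotated = HomToKM.FromBShape (map₂ ψ ∘ g) ψ̂∘g-hom (s≤s (s≤s z≤n)) shape

module HomToKM₀ {k : ℕ} (g : MVert (k + 0) → KMVert k 0) (g-hom : PreservesAdj g) where

  ι : KMVert k 0 → Fin (suc k)
  ι (inj₁ j) = Fin.suc j
  ι (inj₂ o) = Fin.zero

  ι-injective : ∀ {u v} → ι u ≡ ι v → u ≡ v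
  ι-injective {inj₁ _} {inj₁ _} refl = refl
  ι-injective {inj₁ _} {inj₂ o} ()
  ι-injective {inj₂ o} {inj₁ _} ()
  ι-injective {inj₂ o} {inj₂ o} refl = refl

  -- K k ⊗ M 0 is the complete graph K (suc k): a missed vertex or edge would leave
  -- a proper colouring of M (k + 0) with k colours.
  no-k-colouring : (col : MVert (k + 0) → Fin k) → ¬ ProperColouring col
  no-k-colouring col proper = ℕ.<-irrefl (ℕ.+-identityʳ k) (ProperColouring⇒n<c col proper)

  onto-vertices : OntoVertices g
  onto-vertices w with any-MVert? (λ u → g u ≟KM w)
  ... | yes hit  = hit
  ... | no ¬hit = ⊥-elim (no-k-colouring col proper)
    where
    ιw≢ : ∀ u → ι w ≢ ι (g u)
    ιw≢ u eq = ¬hit (u , sym (ι-injective eq))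
    col : MVert (k + 0) → Fin k
    col u = punchOut (ιw≢ u)
    proper : ProperColouring col
    proper u v uv eq =
      KMAdj⇒≢ (g-hom u v uv) (ι-injective (Fin.punchOut-injective (ιw≢ u) (ιw≢ v) eq))

  onto-edges : OntoEdges g
  onto-edges w w′ ww′ with any-MVert? (λ u → any-MVert? λ u′ →
                             T? (MAdj u u′) ×-dec g u ≟KM w ×-dec g u′ ≟KM w′)
  ... | yes (u , hit)  = u , hit
  ... | no ¬hit = ⊥-elim (no-k-colouring col proper)
    where
    merge : KMVert k 0 → Fin (suc k)
    merge z with z ≟KM w′
    ... | yes _ = ι w
    ... | no _  = ι z
    ιw′≢ : ∀ z → ι w′ ≢ merge z
    ιw′≢ z with z ≟KM w′
    ... | yes _   = λ eq → KMAdj⇒≢ ww′ (ι-injective (sym eq))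
    ... | no z≢w′ = λ eq → z≢w′ (ι-injective (sym eq))
    col : MVert (k + 0) → Fin k
    col u = punchOut (ιw′≢ (g u))
    proper : ProperColouring col
    proper u v uv eq with Fin.punchOut-injective (ιw′≢ (g u)) (ιw′≢ (g v)) eq
    ... | merged with g u ≟KM w′ | g v ≟KM w′
    ...   | yes gu≡ | yes gv≡ = KMAdj⇒≢ (g-hom u v uv) (trans gu≡ (sym gv≡))
    ...   | yes gu≡ | no _    = ¬hit (v , u , subst T (MAdj-sym u v) uv , ι-injective (sym merged) , gu≡)
    ...   | no _    | yes gv≡ = ¬hit (u , v , uv , ι-injective merged , gv≡)
    ...   | no _    | no _    = KMAdj⇒≢ (g-hom u v uv) (ι-injective merged)

homs-onto : ∀ k m → m ≢ 1 → (g : MVert (k + m) → KMVert k m) → PreservesAdj g →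
            OntoVertices g × OntoEdges g
homs-onto k zero                _   g g-hom = HomToKM₀.onto-vertices g g-hom , HomToKM₀.onto-edges g g-hom
homs-onto k (suc zero)          m≢1 _ _     = ⊥-elim (m≢1 refl)
homs-onto k (suc (suc zero))    _   g g-hom = HomToKM₂.onto g g-hom
homs-onto k (suc (suc (suc m))) _   g g-hom = onto-vertices , onto-edges
  where open HomToKM.ThreeOrMore g g-hom (s≤s (s≤s (s≤s z≤n)))

KM-homs-onto : ∀ k m → m ≢ 1 → ∀ h → IsHom (M (k + m)) (KM k m) h → IsOnto (M (k + m)) (KM k m) h
KM-homs-onto k m m≢1 h h-hom = onto-vertices , onto-edges
  where
  g : MVert (k + m) → KMVert k m
  g u = decodeKM k m (h (encodeM (k + m) u))
  g-hom : PreservesAdj g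
  g-hom u v uv = subst T (adj-KM-decodeKM k m _ _)
                   (h-hom _ _ (subst T (sym (adj-M-encodeM (k + m) u v)) uv))
  onto : OntoVertices g × OntoEdges g
  onto = homs-onto k m m≢1 g g-hom
  onto-vertices : ∀ y → ∃ λ x → h x ≡ y
  onto-vertices y = let u , gu≡ = proj₁ onto (decodeKM k m y) in
    encodeM (k + m) u , decodeKM-injective k m gu≡
  onto-edges : ∀ y y′ → Adj (KM k m) y y′ → ∃ λ x → ∃ λ x′ → Adj (M (k + m)) x x′ × h x ≡ y × h x′ ≡ y′
  onto-edges y y′ yy′ =
    let u , u′ , uu′ , gu≡ , gu′≡ = proj₂ onto _ _ (subst T (adj-KM-decodeKM k m y y′) yy′) in
    encodeM (k + m) u , encodeM (k + m) u′ , subst T (sym (adj-M-encodeM (k + m) u u′)) uu′ ,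
    decodeKM-injective k m gu≡ , decodeKM-injective k m gu′≡

collapse : ∀ k m → MVert (k + m) → KMVert k m
collapse k m o     = inj₂ o
collapse k m (a i) = map₂ a (splitAt k i)
collapse k m (b i) = map₂ b (splitAt k i)

collapse-adj : ∀ k m (x y : Fin m → MVert m) → (∀ p q → MAdj (x p) (y q) ≡ neq p q) →
               ∀ i j → T (neq i j) → T (KMAdj (map₂ x (splitAt k i)) (map₂ y (splitAt k j)))
collapse-adj k m x y xy i j ij with splitAt k i in si | splitAt k j in sj
... | inj₁ c | inj₁ d = ≢⇒neq {i = c} {d} λ { refl → neq⇒≢ ij (splitAt-injective k m (trans si (sym sj))) }
... | inj₁ _ | inj₂ _ = tt
... | inj₂ _ | inj₁ _ = tt
... | inj₂ p | inj₂ q = subst T (sym (xy p q))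
                          (≢⇒neq {i = p} {q} λ { refl → neq⇒≢ ij (splitAt-injective k m (trans si (sym sj))) })

collapse-hom : ∀ k m → PreservesAdj (collapse k m)
collapse-hom k m o (a j) _ with splitAt k j
... | inj₁ _ = tt
... | inj₂ _ = tt
collapse-hom k m (a i) o _ with splitAt k i
... | inj₁ _ = tt
... | inj₂ _ = tt
collapse-hom k m (a i) (b j) ij = collapse-adj k m a b (λ _ _ → refl) i j ij
collapse-hom k m (b i) (a j) ij = collapse-adj k m b a (λ _ _ → refl) i j ij
collapse-hom k m (b i) (b j) ij = collapse-adj k m b b (λ _ _ → refl) i j ij

KM∈H₀ : ∀ k m → m ≢ 1 → InH₀ (M (k + m)) (KM k m)
KM∈H₀ k m m≢1 = h , h-hom , KM-homs-onto k m m≢1 h h-hom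
  where
  h : Fin (V (M (k + m))) → Fin (V (KM k m))
  h x = encodeKM k m (collapse k m (decodeM (k + m) x))
  h-hom : IsHom (M (k + m)) (KM k m) h
  h-hom x y xy = subst T (sym (adj-KM-encodeKM k m (collapse k m u) (collapse k m v)))
                   (collapse-hom k m u v xy)
    where u = decodeM (k + m) x
          v = decodeM (k + m) y

KM∈H : ∀ k m → m ≢ 1 → InH (M (k + m)) (KM k m)
KM∈H k m m≢1 = KM∈H₀ k m m≢1 , homs-onto⇒minimal (M (k + m)) (KM k m) (KM-homs-onto k m m≢1)

KM↪ : ∀ {k m} Y (e : KMVert k m → Fin (V Y)) → (∀ u v → T (KMAdj u v) → Adj Y (e u) (e v)) →
      (∀ u v → u ≢ v → ¬ T (KMAdj u v) → e u ≢ e v) → KM k m ↪ Y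
KM↪ {k} {m} Y e e-adj e-separates =
  (λ x → e (decodeKM k m x)) ,
  (λ x x′ eq → decodeKM-injective k m (e-injective _ _ eq)) ,
  λ x x′ xx′ → e-adj _ _ (subst T (adj-KM-decodeKM k m x x′) xx′)
  where
  e-injective : ∀ u v → e u ≡ e v → u ≡ v
  e-injective u v eq with u ≟KM v | T? (KMAdj u v)
  ... | yes u≡v | _      = u≡v
  ... | no _    | yes uv = ⊥-elim (Adj⇒≢ Y (e-adj u v uv) eq)
  ... | no u≢v  | no ¬uv = ⊥-elim (e-separates u v u≢v ¬uv eq)

KMAdj-complete : ∀ {s} (u v : KMVert s 0) → u ≢ v → T (KMAdj u v)
KMAdj-complete (inj₁ _) (inj₁ _) u≢v = ≢⇒neq (u≢v ∘ cong inj₁)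
KMAdj-complete (inj₁ _) (inj₂ o) _   = tt
KMAdj-complete (inj₂ o) (inj₁ _) _   = tt
KMAdj-complete (inj₂ o) (inj₂ o) u≢v = ⊥-elim (u≢v refl)

clique↪ : ∀ {s} Y (q : KMVert s 0 → Fin (V Y)) → (∀ u v → u ≢ v → Adj Y (q u) (q v)) → KM s 0 ↪ Y
clique↪ Y q q-adj =
  KM↪ Y q (λ u v uv → q-adj u v (KMAdj⇒≢ uv)) (λ u v u≢v ¬uv → ⊥-elim (¬uv (KMAdj-complete u v u≢v)))

record Split (n : ℕ) (P : Fin n → Set) : Set where
  field
    s t         : ℕ
    s+t≡n       : s + t ≡ n
    σ           : Fin s → Fin n
    τ           : Fin t → Fin n
    σ-injective : ∀ {x y} → σ x ≡ σ y → x ≡ y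
    τ-injective : ∀ {x y} → τ x ≡ τ y → x ≡ y
    σ-P         : ∀ j → P (σ j)
    τ-¬P        : ∀ p → ¬ P (τ p)

  σ≢τ : ∀ j p → σ j ≢ τ p
  σ≢τ j p eq = τ-¬P p (subst P eq (σ-P j))

split : ∀ n {P : Fin n → Set} → (∀ i → Dec (P i)) → Split n P
split zero _ = record
  { s = 0 ; t = 0 ; s+t≡n = refl ; σ = λ () ; τ = λ ()
  ; σ-injective = λ { {()} } ; τ-injective = λ { {()} } ; σ-P = λ () ; τ-¬P = λ () }
split (suc n) {P} P? with split n (P? ∘ Fin.suc) | P? Fin.zero
... | S | yes P0 = record
  { s = suc s ; t = t ; s+t≡n = cong suc s+t≡n
  ; σ = σ′ ; τ = Fin.suc ∘ τ
  ; σ-injective = σ′-injective ; τ-injective = τ-injective ∘ Fin.suc-injective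
  ; σ-P = σ′-P ; τ-¬P = τ-¬P }
  where
  open Split S
  σ′ : Fin (suc s) → Fin (suc n)
  σ′ Fin.zero    = Fin.zero
  σ′ (Fin.suc j) = Fin.suc (σ j)
  σ′-injective : ∀ {x y} → σ′ x ≡ σ′ y → x ≡ y
  σ′-injective {Fin.zero}  {Fin.zero}  _  = refl
  σ′-injective {Fin.suc _} {Fin.suc _} eq = cong Fin.suc (σ-injective (Fin.suc-injective eq))
  σ′-P : ∀ j → P (σ′ j)
  σ′-P Fin.zero    = P0
  σ′-P (Fin.suc j) = σ-P j
... | S | no ¬P0 = record
  { s = s ; t = suc t ; s+t≡n = trans (ℕ.+-suc s t) (cong suc s+t≡n)
  ; σ = Fin.suc ∘ σ ; τ = τ′
  ; σ-injective = σ-injective ∘ Fin.suc-injective ; τ-injective = τ′-injective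
  ; σ-P = σ-P ; τ-¬P = τ′-¬P }
  where
  open Split S
  τ′ : Fin (suc t) → Fin (suc n)
  τ′ Fin.zero    = Fin.zero
  τ′ (Fin.suc p) = Fin.suc (τ p)
  τ′-injective : ∀ {x y} → τ′ x ≡ τ′ y → x ≡ y
  τ′-injective {Fin.zero}  {Fin.zero}  _  = refl
  τ′-injective {Fin.suc _} {Fin.suc _} eq = cong Fin.suc (τ-injective (Fin.suc-injective eq))
  τ′-¬P : ∀ p → ¬ P (τ′ p)
  τ′-¬P Fin.zero    = ¬P0
  τ′-¬P (Fin.suc p) = τ-¬P p

module Classify {n : ℕ} (Y : Graph) (h : Fin (V (M n)) → Fin (V Y)) (h-hom : IsHom (M n) Y h) where

  H : MVert n → Fin (V Y)
  H u = h (encodeM n u)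

  H-adj : ∀ u v → T (MAdj u v) → Adj Y (H u) (H v)
  H-adj u v uv = h-hom _ _ (subst T (sym (adj-M-encodeM n u v)) uv)

  -- H (a x) is already adjacent to every H (b i) with i ≢ x.
  a-universal⇒K↪ : ∀ x → Adj Y (H (a x)) (H (b x)) → KM n 0 ↪ Y
  a-universal⇒K↪ x ax-bx = clique↪ Y q q-adj
    where
    ax-b : ∀ i → Adj Y (H (a x)) (H (b i))
    ax-b i with i ≟ x
    ... | yes refl = ax-bx
    ... | no i≢x   = H-adj (a x) (b i) (≢⇒neq (≢-sym i≢x))
    q : KMVert n 0 → Fin (V Y)
    q (inj₁ i) = H (b i)
    q (inj₂ _) = H (a x)
    q-adj : ∀ u v → u ≢ v → Adj Y (q u) (q v)
    q-adj (inj₁ i) (inj₁ j) u≢v = H-adj (b i) (b j) (≢⇒neq (u≢v ∘ cong inj₁))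
    q-adj (inj₁ i) (inj₂ o) _   = Adj-sym Y (ax-b i)
    q-adj (inj₂ o) (inj₁ j) _   = ax-b j
    q-adj (inj₂ o) (inj₂ o) u≢v = ⊥-elim (u≢v refl)

  open Split (split n (λ i → H (a i) ≟ H (b i)))

  one-unidentified⇒K↪ : (x : Fin n) → (∀ j → σ j ≢ x) → KM (s + 1) 0 ↪ Y
  one-unidentified⇒K↪ x σ≢x = clique↪ Y q q-adj
    where
    q : KMVert (s + 1) 0 → Fin (V Y)
    q (inj₁ c) = [ H ∘ b ∘ σ , (λ _ → H (a x)) ]′ (splitAt s c)
    q (inj₂ _) = H o
    q-o : ∀ c → Adj Y (q (inj₁ c)) (H o)
    q-o c with splitAt s c
    ... | inj₁ j = subst (λ z → Adj Y z (H o)) (σ-P j) (H-adj (a (σ j)) o tt)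
    ... | inj₂ _ = H-adj (a x) o tt
    q-adj : ∀ u v → u ≢ v → Adj Y (q u) (q v)
    q-adj (inj₁ c) (inj₁ d) u≢v with splitAt s c in sc | splitAt s d in sd
    ... | inj₁ j | inj₁ j′ = H-adj (b (σ j)) (b (σ j′)) (≢⇒neq λ eq →
            u≢v (cong inj₁ (splitAt-injective s 1 (trans sc (trans (cong inj₁ (σ-injective eq)) (sym sd))))))
    ... | inj₁ j | inj₂ _  = H-adj (b (σ j)) (a x) (≢⇒neq (σ≢x j))
    ... | inj₂ _ | inj₁ j′ = H-adj (a x) (b (σ j′)) (≢⇒neq (≢-sym (σ≢x j′)))
    ... | inj₂ Fin.zero | inj₂ Fin.zero = ⊥-elim (u≢v (cong inj₁ (splitAt-injective s 1 (trans sc (sym sd)))))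
    q-adj (inj₁ c) (inj₂ o) _   = q-o c
    q-adj (inj₂ o) (inj₁ d) _   = Adj-sym Y (q-o d)
    q-adj (inj₂ o) (inj₂ o) u≢v = ⊥-elim (u≢v refl)

  module Separated (a-separated : ∀ p q → p ≢ q → H (a (τ p)) ≢ H (a (τ q)))
                   (o-b-separated : ∀ p → H o ≢ H (b (τ p))) where

    e : KMVert s t → Fin (V Y)
    e (inj₁ j)     = H (b (σ j))
    e (inj₂ o)     = H o
    e (inj₂ (a p)) = H (a (τ p))
    e (inj₂ (b p)) = H (b (τ p))

    clique-adj : ∀ j w → T (KMAdj (inj₁ j) w) → Adj Y (e (inj₁ j)) (e w)
    clique-adj j (inj₁ j′) jj′ = H-adj (b (σ j)) (b (σ j′)) (≢⇒neq (neq⇒≢ jj′ ∘ σ-injective))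
    clique-adj j (inj₂ o) _ = subst (λ z → Adj Y z (H o)) (σ-P j) (H-adj (a (σ j)) o tt)
    clique-adj j (inj₂ (a p)) _ = H-adj (b (σ j)) (a (τ p)) (≢⇒neq (σ≢τ j p))
    clique-adj j (inj₂ (b p)) _ = H-adj (b (σ j)) (b (τ p)) (≢⇒neq (σ≢τ j p))

    e-adj : ∀ u v → T (KMAdj u v) → Adj Y (e u) (e v)
    e-adj (inj₁ j) w jw = clique-adj j w jw
    e-adj (inj₂ u) (inj₁ j) _ = Adj-sym Y (clique-adj j (inj₂ u) tt)
    e-adj (inj₂ o) (inj₂ (a p)) _ = H-adj o (a (τ p)) tt
    e-adj (inj₂ (a p)) (inj₂ o) _ = H-adj (a (τ p)) o tt
    e-adj (inj₂ (a p)) (inj₂ (b q)) pq = H-adj (a (τ p)) (b (τ q)) (≢⇒neq (neq⇒≢ pq ∘ τ-injective))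
    e-adj (inj₂ (b p)) (inj₂ (a q)) pq = H-adj (b (τ p)) (a (τ q)) (≢⇒neq (neq⇒≢ pq ∘ τ-injective))
    e-adj (inj₂ (b p)) (inj₂ (b q)) pq = H-adj (b (τ p)) (b (τ q)) (≢⇒neq (neq⇒≢ pq ∘ τ-injective))

    e-separates : ∀ u v → u ≢ v → ¬ T (KMAdj u v) → e u ≢ e v
    e-separates (inj₁ j) (inj₁ j′) u≢v ¬uv = ⊥-elim (¬uv (≢⇒neq (u≢v ∘ cong inj₁)))
    e-separates (inj₁ _) (inj₂ _) _ ¬uv = ⊥-elim (¬uv tt)
    e-separates (inj₂ _) (inj₁ _) _ ¬uv = ⊥-elim (¬uv tt)
    e-separates (inj₂ o) (inj₂ o) u≢v _ = ⊥-elim (u≢v refl)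
    e-separates (inj₂ o) (inj₂ (a _)) _ ¬uv = ⊥-elim (¬uv tt)
    e-separates (inj₂ o) (inj₂ (b p)) _ _ = o-b-separated p
    e-separates (inj₂ (a _)) (inj₂ o) _ ¬uv = ⊥-elim (¬uv tt)
    e-separates (inj₂ (a p)) (inj₂ (a q)) u≢v _ = a-separated p q (u≢v ∘ cong (inj₂ ∘ a))
    e-separates (inj₂ (a p)) (inj₂ (b q)) _ ¬uv with p ≟ q
    ... | yes refl = τ-¬P p
    ... | no _     = ⊥-elim (¬uv tt)
    e-separates (inj₂ (b p)) (inj₂ o) _ _ = o-b-separated p ∘ sym
    e-separates (inj₂ (b p)) (inj₂ (a q)) _ ¬uv with p ≟ q
    ... | yes refl = τ-¬P p ∘ sym
    ... | no _     = ⊥-elim (¬uv tt)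
    e-separates (inj₂ (b p)) (inj₂ (b q)) u≢v ¬uv = ⊥-elim (¬uv (≢⇒neq (u≢v ∘ cong (inj₂ ∘ b))))

    KMst↪ : KM s t ↪ Y
    KMst↪ = KM↪ Y e e-adj e-separates

  complete : KM n 0 ↪ Y → ∃₂ λ s′ t′ → s′ + t′ ≡ n × t′ ≢ 1 × KM s′ t′ ↪ Y
  complete K↪Y = n , 0 , ℕ.+-identityʳ n , (λ ()) , K↪Y

  -- If h merges two unidentified a's, or o with an unidentified b, some H (a x) is adjacent
  -- to every H (b i). Otherwise the images of the b (σ j), of o and of the unidentified pairs
  -- span a copy of K s ⊗ M t, and when t = 1 they contain a clique on n + 1 vertices instead.
  classify : ∃₂ λ s′ t′ → s′ + t′ ≡ n × t′ ≢ 1 × KM s′ t′ ↪ Y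
  classify with any? (λ p → any? λ q → ¬? (p ≟ q) ×-dec H (a (τ p)) ≟ H (a (τ q)))
  ... | yes (p , q , p≢q , eq) = complete (a-universal⇒K↪ (τ p)
          (subst (λ z → Adj Y z (H (b (τ p)))) (sym eq) (H-adj (a (τ q)) (b (τ p)) (≢⇒neq (p≢q ∘ τ-injective ∘ sym)))))
  ... | no ¬aa with any? (λ p → H o ≟ H (b (τ p)))
  ...   | yes (p , eq) = complete (a-universal⇒K↪ (τ p) (subst (Adj Y (H (a (τ p)))) eq (H-adj (a (τ p)) o tt)))
  ...   | no ¬ob with t ℕ.≟ 1
  ...     | no t≢1  = s , t , s+t≡n , t≢1 ,
                      Separated.KMst↪ (λ p q p≢q eq → ¬aa (p , q , p≢q , eq)) (λ p eq → ¬ob (p , eq))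
  ...     | yes t≡1 = complete (subst (λ z → KM z 0 ↪ Y) (trans (cong (s +_) (sym t≡1)) s+t≡n)
                        (one-unidentified⇒K↪ (τ x₀) (λ j → σ≢τ j x₀)))
    where
    x₀ : Fin t
    x₀ = subst Fin (sym t≡1) Fin.zero

KMShape : ℕ → Graph → Set
KMShape n Y = ∃₂ λ s t → s + t ≡ n × t ≢ 1 × Y ≅ KM s t

KMShape⇒InH : ∀ {n Y} → KMShape n Y → InH (M n) Y
KMShape⇒InH {Y = Y} (s , t , refl , t≢1 , Y≅KM) =
  InH-respʳ-≅ {M (s + t)} {KM s t} {Y} (KM∈H s t t≢1) (≅-sym {Y} {KM s t} Y≅KM)

InH⇒KMShape : ∀ {n Y} → InH (M n) Y → KMShape n Y
InH⇒KMShape {Y = Y} ((h , h-hom , _) , Y-minimal) with Classify.classify Y h h-hom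
... | s , t , refl , t≢1 , KM↪Y =
  s , t , refl , t≢1 , ≅-sym {KM s t} {Y} (Y-minimal (KM s t) (KM∈H₀ s t t≢1) KM↪Y)

n∸k≡1⇒k≡n∸1 : ∀ {n k} → n ∸ k ≡ 1 → k ≡ n ∸ 1
n∸k≡1⇒k≡n∸1 {n} {k} n∸k≡1 with k ℕ.≤? n
... | yes k≤n = trans (sym (ℕ.m+n∸n≡m k 1))
                  (cong (_∸ 1) (trans (cong (k +_) (sym n∸k≡1)) (ℕ.m+[n∸m]≡n k≤n)))
... | no k≰n with trans (sym (ℕ.m≤n⇒m∸n≡0 (ℕ.<⇒≤ (ℕ.≰⇒> k≰n)))) n∸k≡1
...   | ()

k≡n∸1⇒n∸k≡1 : ∀ {n k} → 1 ≤ n → k ≡ n ∸ 1 → n ∸ k ≡ 1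
k≡n∸1⇒n∸k≡1 1≤n refl = ℕ.m∸[m∸n]≡n 1≤n

KMShape⇒ : ∀ {n Y} → 1 ≤ n → KMShape n Y → ∃ λ k → k ≤ n × k ≢ n ∸ 1 × Y ≅ (K k ⊗ M (n ∸ k))
KMShape⇒ {Y = Y} 1≤n (s , t , refl , t≢1 , Y≅KM) =
  s , ℕ.m≤m+n s t ,
  (λ s≡ → t≢1 (trans (sym (ℕ.m+n∸m≡n s t)) (k≡n∸1⇒n∸k≡1 1≤n s≡))) ,
  subst (λ z → Y ≅ KM s z) (sym (ℕ.m+n∸m≡n s t)) Y≅KM

⇒KMShape : ∀ {n Y} → (∃ λ k → k ≤ n × k ≢ n ∸ 1 × Y ≅ (K k ⊗ M (n ∸ k))) → KMShape n Y
⇒KMShape (k , k≤n , k≢n∸1 , Y≅KM) = k , _ , ℕ.m+[n∸m]≡n k≤n , k≢n∸1 ∘ n∸k≡1⇒k≡n∸1 , Y≅KM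

-- Counting H(M n): the sizes of the M part are 0, 2, 3, …, n.

M-size : ∀ {n} → Fin n → ℕ
M-size Fin.zero    = 0
M-size (Fin.suc i) = suc (suc (toℕ i))

M-size-≤ : ∀ {n} (i : Fin n) → M-size i ≤ n
M-size-≤ Fin.zero    = z≤n
M-size-≤ (Fin.suc i) = s≤s (Fin.toℕ<n i)

M-size-≢1 : ∀ {n} (i : Fin n) → M-size i ≢ 1
M-size-≢1 Fin.zero    ()
M-size-≢1 (Fin.suc _) ()

M-size-injective : ∀ {n} {i j : Fin n} → M-size i ≡ M-size j → i ≡ j
M-size-injective {i = Fin.zero}  {Fin.zero}  _  = refl
M-size-injective {i = Fin.suc _} {Fin.suc _} eq =
  cong Fin.suc (Fin.toℕ-injective (ℕ.suc-injective (ℕ.suc-injective eq)))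

M-size-hits : ∀ {n} t → 1 ≤ n → t ≤ n → t ≢ 1 → ∃ λ i → M-size {n} i ≡ t
M-size-hits zero                (s≤s _) _         _   = Fin.zero , refl
M-size-hits (suc zero)          _       _         t≢1 = ⊥-elim (t≢1 refl)
M-size-hits (suc (suc t))       _       (s≤s t<n) _   =
  Fin.suc (fromℕ< t<n) , cong (suc ∘ suc) (Fin.toℕ-fromℕ< t<n)

V-KM : ∀ s t → V (KM s t) ≡ suc (s + t + t)
V-KM s t = trans (ℕ.+-suc s (t + t)) (cong suc (sym (ℕ.+-assoc s t t)))

HasHCount-M : ∀ n → 1 ≤ n → HasHCount (M n) n
HasHCount-M n 1≤n = G , (λ i → KMShape⇒InH {n} {G i} (G-shape i)) , G-distinct , G-complete
  where
  G : Fin n → Graph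
  G i = KM (n ∸ M-size i) (M-size i)

  G-shape : ∀ i → KMShape n (G i)
  G-shape i = _ , M-size i , ℕ.m∸n+n≡m (M-size-≤ i) , M-size-≢1 i , ≅-refl (G i)

  V-G : ∀ i → V (G i) ≡ suc (n + M-size i)
  V-G i = trans (V-KM _ _) (cong (λ z → suc (z + M-size i)) (ℕ.m∸n+n≡m (M-size-≤ i)))

  G-distinct : ∀ i j → G i ≅ G j → i ≡ j
  G-distinct i j Gi≅Gj = M-size-injective (ℕ.+-cancelˡ-≡ n _ _ (ℕ.suc-injective
    (trans (sym (V-G i)) (trans (≅⇒≡V {G i} {G j} Gi≅Gj) (V-G j)))))

  G-complete : ∀ Y → InH (M n) Y → ∃ λ i → Y ≅ G i
  G-complete Y Y∈H with InH⇒KMShape {n} {Y} Y∈H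
  ... | s , t , s+t≡n , t≢1 , Y≅KM with M-size-hits t 1≤n (subst (t ≤_) s+t≡n (ℕ.m≤n+m t s)) t≢1
  ...   | i , refl = i , subst (λ z → Y ≅ KM z (M-size i)) (sym n∸t≡s) Y≅KM
    where
    n∸t≡s : n ∸ M-size i ≡ s
    n∸t≡s = trans (cong (_∸ M-size i) (sym s+t≡n)) (ℕ.m+n∸n≡m s (M-size i))

lemma7 : (n : ℕ) → 1 ≤ n →
    (∀ (Y : Graph) → InH (M n) Y ⇔
    (∃ λ k → k ≤ n × k ≢ n ∸ 1 × Y ≅ (K k ⊗ M (n ∸ k))))
    × IsChromaticNumber (M n) (suc n)
    × HasHCount (M n) n
lemma7 n 1≤n =
  (λ Y → mk⇔ (KMShape⇒ {n} {Y} 1≤n ∘ InH⇒KMShape {n} {Y}) (KMShape⇒InH {n} {Y} ∘ ⇒KMShape {n} {Y})) ,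
  χ-M n ,
  HasHCount-M n 1≤n
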